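{- For all formulas $\phi,\psi,\chi$ of $\mathcal{L}(W)$, the formula $W\psi\land W(\phi\land\psi)\to W\big((W\chi\to W(\phi\land\chi))\land\psi\big)$ is valid on the class of transitive frames.
   Context: Fix a nonempty set $\mathbf{P}$ of propositional variables. $\mathcal{L}(W)$: $\phi::=p\mid\neg\phi\mid(\phi\land\phi)\mid W\phi$ ($p\in\mathbf{P}$), other connectives as usual. A frame is $(S,R)$, $S\neq\emptyset$, $R\subseteq S\times S$; a model based on it adds $V:\mathbf{P}\to2^S$. Truth: Boolean clauses as usual; $\mathcal{M},s\vDash W\phi$ iff $\mathcal{M},s\nvDash\phi$ and $\mathcal{M},t\vDash\phi$ for all $t$ with $sRt$. A formula is valid on a class of frames if it is true at every state of every model based on a frame in the class. -}

module Defs where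

open import Data.Empty using (⊥)
open import Data.Product using (_×_; Σ)
open import Relation.Binary.Core using (Rel)
open import Relation.Binary.Definitions using (Transitive)
open import Relation.Nullary using (¬_)

data Form (P : Set) : Set where
  var  : P → Form P
  ¬'_  : Form P → Form P
  _∧'_ : Form P → Form P → Form P
  W    : Form P → Form P

infixr 6 _∧'_
infix 7 ¬'_

_→'_ : {P : Set} → Form P → Form P → Form P
φ →' ψ = ¬' (φ ∧' ¬' ψ)
infixr 5 _→'_

record Frame : Set₁ where
  field
    S   : Set
    inh : S
    R   : Rel S _

record Model (P : Set) : Set₁ where
  field
    frame : Frame
  open Frame frame public
  field
    V : P → S → Set

_,_⊨_ : {P : Set} → (M : Model P) → Model.S M → Form P → Set
M , s ⊨ var p = Model.V M p s
M , s ⊨ (¬' φ) = ¬ (M , s ⊨ φ)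
M , s ⊨ (φ ∧' ψ) = (M , s ⊨ φ) × (M , s ⊨ ψ)
M , s ⊨ W φ = ¬ (M , s ⊨ φ) × (∀ t → Model.R M s t → M , t ⊨ φ)

ValidOn : {P : Set} → (Frame → Set) → Form P → Set₁
ValidOn {P} C φ = (F : Frame) → C F → (V : P → Frame.S F → Set) →
  (s : Frame.S F) → record { frame = F ; V = V } , s ⊨ φ

IsTransitive : Frame → Set
IsTransitive F = Transitive (Frame.R F)

module Submission where

open import Defs
open import Data.Product using (_,_; proj₁; proj₂)
open import Relation.Binary.Definitions using (Transitive)

-- Wψ makes ψ false at s, so the consequent fails at s; at a successor t, ψ holds by Wψ, and
-- Wχ → W(φ ∧ χ) holds because, by transitivity, every successor of t is a successor of s,
-- where φ holds by W(φ ∧ ψ).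

module _ {P : Set} (M : Model P) where

  open Model M using (R)

  ⊨→'-intro : ∀ {s} (φ ψ : Form P) →
    (M , s ⊨ φ → M , s ⊨ ψ) → M , s ⊨ (φ →' ψ)
  ⊨→'-intro _ _ φ⇒ψ (sφ , s¬ψ) = s¬ψ (φ⇒ψ sφ)

  ⊨W∧-successor : Transitive R → ∀ {s t} (φ ψ χ : Form P) →
    M , s ⊨ W (φ ∧' ψ) → R s t → M , t ⊨ W χ → M , t ⊨ W (φ ∧' χ)
  ⊨W∧-successor trans _ _ _ (_ , φψ-after-s) st (t¬χ , χ-after-t) =
    (λ tφχ → t¬χ (proj₂ tφχ)) ,
    λ u tu → proj₁ (φψ-after-s u (trans st tu)) , χ-after-t u tu

  ⊨W-axiom : Transitive R → ∀ {s} (φ ψ χ : Form P) →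
    M , s ⊨ W ψ → M , s ⊨ W (φ ∧' ψ) → M , s ⊨ W ((W χ →' W (φ ∧' χ)) ∧' ψ)
  ⊨W-axiom trans φ ψ χ (s¬ψ , ψ-after-s) sWφψ =
    (λ s⊨ → s¬ψ (proj₂ s⊨)) ,
    λ t st → ⊨→'-intro (W χ) (W (φ ∧' χ)) (⊨W∧-successor trans φ ψ χ sWφψ st) ,
             ψ-after-s t st

mainTheorem18 : {P : Set} → P → (φ ψ χ : Form P) →
    ValidOn IsTransitive ((W ψ ∧' W (φ ∧' ψ)) →' W ((W χ →' W (φ ∧' χ)) ∧' ψ))
mainTheorem18 _ φ ψ χ F trans V s =
  ⊨→'-intro M (W ψ ∧' W (φ ∧' ψ)) (W ((W χ →' W (φ ∧' χ)) ∧' ψ))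
    (λ (sWψ , sWφψ) → ⊨W-axiom M trans φ ψ χ sWψ sWφψ)
  where
    M = record { frame = F ; V = V }
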